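{- Let $\alpha=(\alpha_1,\ldots,\alpha_k)$ be a dotted composition and let $\alpha_{i_1},\ldots,\alpha_{i_s}$ be its undotted components. Then the interval $\alpha^{\downarrow}=\{\beta:\beta\preceq\alpha\}$ is isomorphic as a poset to $B_{\alpha_{i_1}-1}\times\cdots\times B_{\alpha_{i_s}-1}$; in particular it is a Boolean lattice of rank $(\alpha_{i_1}-1)+\cdots+(\alpha_{i_s}-1)$.
   Context: A dotted composition is a finite sequence whose entries are positive integers (undotted) or dotted nonnegative integers $\dot a$, $a\in\mathbb{N}_0$. Partial order: $\beta$ covers $\alpha=(\alpha_1,\ldots,\alpha_k)$ if there is $i\in[k-1]$ with $\alpha_i,\alpha_{i+1}$ both undotted and $\beta=(\alpha_1,\ldots,\alpha_{i-1},\alpha_i+\alpha_{i+1},\alpha_{i+2},\ldots,\alpha_k)$; $\preceq$ is the reflexive-transitive closure of this relation. $B_r$ denotes the Boolean lattice of subsets of $[r]$ ordered by inclusion ($B_0$ a one-element poset). -}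

module Defs where

open import Data.Nat using (ℕ; zero; suc; _+_; _∸_; NonZero)
open import Data.List using (List; []; _∷_)
open import Data.Bool using (Bool)
open import Data.Unit using (⊤; tt)
open import Data.Product using (Σ; _×_; _,_; proj₁; proj₂)
open import Data.Fin.Subset using (Subset; _⊆_)
open import Relation.Binary.PropositionalEquality using (_≡_)
open import Relation.Binary.Construct.Closure.ReflexiveTransitive using (Star)

data Entry : Set where
  und : (n : ℕ) → .⦃ nz : NonZero n ⦄ → Entry
  dot : (a : ℕ) → Entry

DComp : Set
DComp = List Entry

+-nonZero : (m n : ℕ) → .⦃ _ : NonZero m ⦄ → NonZero (m + n)
+-nonZero (suc m) n = _

-- Covering relation:  Covers α β  means  "β covers α", i.e. β arises from α
-- by adding two adjacent undotted entries.
data Covers : DComp → DComp → Set where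
  here  : ∀ (m n : ℕ) ⦃ nm : NonZero m ⦄ ⦃ nn : NonZero n ⦄ (rest : DComp) →
          Covers (und m ∷ und n ∷ rest) (und (m + n) ⦃ +-nonZero m n ⦄ ∷ rest)
  there : ∀ (x : Entry) {α β : DComp} → Covers α β → Covers (x ∷ α) (x ∷ β)

_⪯_ : DComp → DComp → Set
β ⪯ α = Star Covers β α

Down : DComp → Set
Down α = Σ DComp (λ β → β ⪯ α)

ranks : DComp → List ℕ
ranks []            = []
ranks (und n ∷ α)   = (n ∸ 1) ∷ ranks α
ranks (dot a ∷ α)   = ranks α

-- Product of Boolean lattices B_{r_1} × ... × B_{r_s}
-- (B_r = subsets of [r], represented by Data.Fin.Subset r, ordered by ⊆)
BProd : List ℕ → Set
BProd []       = ⊤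
BProd (r ∷ rs) = Subset r × BProd rs

_≤B_ : {rs : List ℕ} → BProd rs → BProd rs → Set
_≤B_ {[]}     _ _ = ⊤
_≤B_ {r ∷ rs} (x , xs) (y , ys) = (x ⊆ y) × (xs ≤B ys)

record DownIso (α : DComp) (B : Set) (_≤_ : B → B → Set) : Set where
  field
    to      : Down α → B
    from    : B → Down α
    from-to : ∀ x → proj₁ (from (to x)) ≡ proj₁ x
    to-from : ∀ y → to (from y) ≡ y
    mono    : ∀ x y → proj₁ x ⪯ proj₁ y → to x ≤ to y
    reflect : ∀ x y → to x ≤ to y → proj₁ x ⪯ proj₁ y

-- A refinement of α refines each undotted entry n on its own into a
-- composition of n, determined by which of its n − 1 gaps stay joined, and
-- leaves the dotted entries alone.  Refining further can only unjoin gaps, and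
-- unjoining a single gap is a covering, so recording the joined gaps is an
-- order isomorphism from α↓ onto the product of the B_{n−1}.
module Submission where

open import Defs
open import Data.Nat.ListAction using (sum)
open import Data.Product using (Σ; ∃; _×_; _,_; proj₁; proj₂)
open import Data.Fin.Subset using (Subset; _⊆_; ⊤; inside; outside)

open import Data.Bool.Base using (_≤_; f≤t; b≤b)
open import Data.Bool.Properties using (≤-refl)
open import Data.Fin.Subset.Properties using (⊆-refl; ⊆-trans; ⊆⊤; out⊆; in⊆in; drop-∷-⊆)
open import Data.List.Base using ([]; _∷_)
open import Data.List.Properties using (∷-injectiveˡ; ∷-injectiveʳ)
open import Data.Nat.Base using (ℕ; zero; suc; _+_; NonZero)
open import Data.Nat.Properties using (suc-injective)
open import Data.Sum.Base using (_⊎_; inj₁; inj₂)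
open import Data.Unit.Base using (tt)
open import Data.Vec.Base as Vec using ([]; _∷_; _++_; take; drop)
open import Data.Vec.Properties using (take++drop≡id; ++-injective)
open import Data.Vec.Relation.Binary.Pointwise.Inductive as Pointwise using (Pointwise; []; _∷_; ++⁺; ++⁻)
open import Relation.Binary.Construct.Closure.ReflexiveTransitive using (ε; _◅_; _◅◅_; gmap)
open import Relation.Binary.PropositionalEquality

und-cong : ∀ {m n} .⦃ _ : NonZero m ⦄ .⦃ _ : NonZero n ⦄ → m ≡ n → und m ≡ und n
und-cong refl = refl

und-injective : ∀ {m n} .⦃ _ : NonZero m ⦄ .⦃ _ : NonZero n ⦄ → und m ≡ und n → m ≡ n
und-injective refl = refl

incHead : DComp → DComp
incHead []          = []
incHead (und n ∷ β) = und (suc n) ∷ β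
incHead (dot a ∷ β) = dot a ∷ β

incHead-covers : ∀ {β γ} → Covers β γ → Covers (incHead β) (incHead γ)
incHead-covers (here m n rest)    = here (suc m) n rest
incHead-covers (there (und n) c)  = there (und (suc n)) c
incHead-covers (there (dot a) c)  = there (dot a) c

⊆⇒pointwise : ∀ {m} {p q : Subset m} → p ⊆ q → Pointwise _≤_ p q
⊆⇒pointwise {p = []}          {[]}          _ = []
⊆⇒pointwise {p = outside ∷ p} {outside ∷ q} s = b≤b ∷ ⊆⇒pointwise (drop-∷-⊆ s)
⊆⇒pointwise {p = outside ∷ p} {inside ∷ q}  s = f≤t ∷ ⊆⇒pointwise (drop-∷-⊆ s)
⊆⇒pointwise {p = inside ∷ p}  {inside ∷ q}  s = b≤b ∷ ⊆⇒pointwise (drop-∷-⊆ s)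
⊆⇒pointwise {p = inside ∷ p}  {outside ∷ q} s with s Vec.here
... | ()

pointwise⇒⊆ : ∀ {m} {p q : Subset m} → Pointwise _≤_ p q → p ⊆ q
pointwise⇒⊆ []                   ()
pointwise⇒⊆ (f≤t ∷ ps)            = out⊆ (pointwise⇒⊆ ps)
pointwise⇒⊆ (b≤b {outside} ∷ ps)  = out⊆ (pointwise⇒⊆ ps)
pointwise⇒⊆ (b≤b {inside} ∷ ps)   = in⊆in (pointwise⇒⊆ ps)

-- block S ρ is the composition of suc m into undotted parts whose i-th gap
-- is joined iff i ∈ S, followed by ρ.  Its head is und (suc (firstPart S)),
-- so block (inside ∷ S) ρ reduces to incHead (block S ρ).
mutual
  firstPart : ∀ {m} → Subset m → ℕ
  firstPart []            = 0
  firstPart (outside ∷ S) = 0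
  firstPart (inside ∷ S)  = suc (firstPart S)

  laterParts : ∀ {m} → Subset m → DComp → DComp
  laterParts []            ρ = ρ
  laterParts (outside ∷ S) ρ = block S ρ
  laterParts (inside ∷ S)  ρ = laterParts S ρ

  block : ∀ {m} → Subset m → DComp → DComp
  block S ρ = und (suc (firstPart S)) ∷ laterParts S ρ

block-⊤ : ∀ m ρ → block (⊤ {m}) ρ ≡ und (suc m) ∷ ρ
block-⊤ zero    ρ = refl
block-⊤ (suc m) ρ = cong incHead (block-⊤ m ρ)

block-covers⁺ : ∀ {m} (S : Subset m) {ρ σ} → Covers ρ σ → Covers (block S ρ) (block S σ)
block-covers⁺ []            c = there (und 1) c
block-covers⁺ (outside ∷ S) c = there (und 1) (block-covers⁺ S c)
block-covers⁺ (inside ∷ S)  c = incHead-covers (block-covers⁺ S c)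

block-mono : ∀ {m} {S T : Subset m} ρ → Pointwise _≤_ S T → block S ρ ⪯ block T ρ
block-mono ρ []                    = ε
block-mono ρ (b≤b {outside} ∷ S≤T) = gmap (und 1 ∷_) (there (und 1)) (block-mono ρ S≤T)
block-mono ρ (b≤b {inside} ∷ S≤T)  = gmap incHead incHead-covers (block-mono ρ S≤T)
block-mono {T = inside ∷ T} ρ (f≤t ∷ S≤T) =
  gmap (und 1 ∷_) (there (und 1)) (block-mono ρ S≤T) ◅◅ here 1 (suc (firstPart T)) (laterParts T ρ) ◅ ε

-- Cutting the first part, of size suc m + suc n, after its (suc m)-th cell
-- unjoins gap m of S.
splitFirstPart : ∀ {k} (S : Subset k) ρ m n → firstPart S ≡ m + suc n →
  Σ (Subset k) λ T → Pointwise _≤_ T S × block T ρ ≡ und (suc m) ∷ und (suc n) ∷ laterParts S ρ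
splitFirstPart []            ρ zero    n ()
splitFirstPart []            ρ (suc m) n ()
splitFirstPart (outside ∷ S) ρ zero    n ()
splitFirstPart (outside ∷ S) ρ (suc m) n ()
splitFirstPart (inside ∷ S)  ρ zero    n e =
  outside ∷ S , f≤t ∷ Pointwise.refl ≤-refl , cong (λ β → und 1 ∷ β ∷ laterParts S ρ) (und-cong e)
splitFirstPart (inside ∷ S)  ρ (suc m) n e with splitFirstPart S ρ m n (suc-injective e)
... | T , T≤S , eq = inside ∷ T , b≤b ∷ T≤S , cong incHead eq

block-covers⁻ : ∀ {k} (S : Subset k) ρ {β γ} → Covers β γ → γ ≡ block S ρ →
  (Σ (Subset k) λ T → Pointwise _≤_ T S × block T ρ ≡ β) ⊎ (∃ λ ρ′ → Covers ρ′ ρ × block S ρ′ ≡ β)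
block-covers⁻ S ρ (here zero    n ⦃ () ⦄ r) e
block-covers⁻ S ρ (here (suc m) zero ⦃ _ ⦄ ⦃ () ⦄ r) e
block-covers⁻ S ρ (here (suc m) (suc n) r) e
  with splitFirstPart S ρ m n (sym (suc-injective (und-injective (∷-injectiveˡ e))))
... | T , T≤S , eq = inj₁ (T , T≤S , trans eq (cong (λ σ → und (suc m) ∷ und (suc n) ∷ σ) (sym (∷-injectiveʳ e))))
block-covers⁻ []            ρ (there x c) refl = inj₂ (_ , c , refl)
block-covers⁻ (outside ∷ S) ρ (there x c) refl with block-covers⁻ S ρ c refl
... | inj₁ (T , T≤S , eq)  = inj₁ (outside ∷ T , b≤b ∷ T≤S , cong (und 1 ∷_) eq)
... | inj₂ (ρ′ , c′ , eq) = inj₂ (ρ′ , c′ , cong (und 1 ∷_) eq)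
block-covers⁻ (inside ∷ S)  ρ (there x c) refl with block-covers⁻ S ρ (there (und (suc (firstPart S))) c) refl
... | inj₁ (T , T≤S , eq)  = inj₁ (inside ∷ T , b≤b ∷ T≤S , cong incHead eq)
... | inj₂ (ρ′ , c′ , eq) = inj₂ (ρ′ , c′ , cong incHead eq)

block-injective : ∀ {k} (S T : Subset k) {ρ σ} → block S ρ ≡ block T σ → S ≡ T × ρ ≡ σ
block-injective []            []            refl = refl , refl
block-injective (outside ∷ S) (outside ∷ T) e with block-injective S T (∷-injectiveʳ e)
... | refl , ρ≡σ = refl , ρ≡σ
block-injective (inside ∷ S)  (inside ∷ T)  e
  with block-injective S T (cong₂ _∷_ (und-cong (suc-injective (und-injective (∷-injectiveˡ e)))) (∷-injectiveʳ e))
... | refl , ρ≡σ = refl , ρ≡σ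
block-injective (outside ∷ S) (inside ∷ T)  e with und-injective (∷-injectiveˡ e)
... | ()
block-injective (inside ∷ S)  (outside ∷ T) e with und-injective (∷-injectiveˡ e)
... | ()

full : ∀ rs → BProd rs
full []       = tt
full (r ∷ rs) = ⊤ , full rs

≤B-refl : ∀ {rs} (x : BProd rs) → x ≤B x
≤B-refl {[]}     _       = tt
≤B-refl {r ∷ rs} (S , x) = ⊆-refl , ≤B-refl x

≤B-trans : ∀ {rs} {x y z : BProd rs} → x ≤B y → y ≤B z → x ≤B z
≤B-trans {[]}     _           _           = tt
≤B-trans {r ∷ rs} (S⊆T , x≤y) (T⊆U , y≤z) = ⊆-trans S⊆T T⊆U , ≤B-trans x≤y y≤z

≤B-full : ∀ {rs} (x : BProd rs) → x ≤B full rs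
≤B-full {[]}     _       = tt
≤B-full {r ∷ rs} (S , x) = ⊆⊤ , ≤B-full x

decode : (α : DComp) → BProd (ranks α) → DComp
decode []          _       = []
decode (und n ∷ α) (S , x) = block S (decode α x)
decode (dot a ∷ α) x       = dot a ∷ decode α x

decode-full : ∀ α → decode α (full (ranks α)) ≡ α
decode-full []                    = refl
decode-full (und (suc n) ∷ α)     = trans (block-⊤ n _) (cong (und (suc n) ∷_) (decode-full α))
decode-full (und zero ⦃ () ⦄ ∷ α)
decode-full (dot a ∷ α)           = cong (dot a ∷_) (decode-full α)

decode-mono : ∀ α {x y : BProd (ranks α)} → x ≤B y → decode α x ⪯ decode α y
decode-mono []          _ = ε
decode-mono (und n ∷ α) {S , x} {T , y} (S⊆T , x≤y) =
  gmap (block S) (block-covers⁺ S) (decode-mono α x≤y) ◅◅ block-mono (decode α y) (⊆⇒pointwise S⊆T)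
decode-mono (dot a ∷ α) x≤y = gmap (dot a ∷_) (there (dot a)) (decode-mono α x≤y)

decode-covers⁻ : ∀ α (y : BProd (ranks α)) {β} → Covers β (decode α y) →
  Σ (BProd (ranks α)) λ x → x ≤B y × decode α x ≡ β
decode-covers⁻ []          _ ()
decode-covers⁻ (und n ∷ α) (S , y) c with block-covers⁻ S (decode α y) c refl
... | inj₁ (T , T≤S , eq) = (T , y) , (pointwise⇒⊆ T≤S , ≤B-refl y) , eq
... | inj₂ (ρ , c′ , eq) with decode-covers⁻ α y c′
...   | x , x≤y , eq′ = (S , x) , (⊆-refl , x≤y) , trans (cong (block S) eq′) eq
decode-covers⁻ (dot a ∷ α) y (there _ c) with decode-covers⁻ α y c
... | x , x≤y , eq = x , x≤y , cong (dot a ∷_) eq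

⪯-decode⁻ : ∀ α (y : BProd (ranks α)) {β} → β ⪯ decode α y →
  Σ (BProd (ranks α)) λ x → x ≤B y × decode α x ≡ β
⪯-decode⁻ α y ε = y , ≤B-refl y , refl
⪯-decode⁻ α y (c ◅ β′⪯y) with ⪯-decode⁻ α y β′⪯y
... | x′ , x′≤y , refl with decode-covers⁻ α x′ c
...   | x , x≤x′ , eq = x , ≤B-trans x≤x′ x′≤y , eq

decode-injective : ∀ α (x y : BProd (ranks α)) → decode α x ≡ decode α y → x ≡ y
decode-injective []          tt      tt      _  = refl
decode-injective (und n ∷ α) (S , x) (T , y) eq with block-injective S T eq
... | refl , eq′ = cong (S ,_) (decode-injective α x y eq′)
decode-injective (dot a ∷ α) x       y       eq = decode-injective α x y (∷-injectiveʳ eq)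

downIso : ∀ α → DownIso α (BProd (ranks α)) _≤B_
downIso α = record
  { to      = encode
  ; from    = λ x → decode α x , decode-⪯ x
  ; from-to = decode-encode
  ; to-from = λ x → decode-injective α _ _ (decode-encode (decode α x , decode-⪯ x))
  ; mono    = encode-mono
  ; reflect = λ β γ x≤y → subst₂ _⪯_ (decode-encode β) (decode-encode γ) (decode-mono α x≤y)
  }
  where
  decode-⪯ : ∀ x → decode α x ⪯ α
  decode-⪯ x = subst (decode α x ⪯_) (decode-full α) (decode-mono α (≤B-full x))

  below : (β : Down α) → proj₁ β ⪯ decode α (full (ranks α))
  below (β , β⪯α) = subst (β ⪯_) (sym (decode-full α)) β⪯α

  encode : Down α → BProd (ranks α)
  encode β = proj₁ (⪯-decode⁻ α _ (below β))

  decode-encode : ∀ β → decode α (encode β) ≡ proj₁ β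
  decode-encode β = proj₂ (proj₂ (⪯-decode⁻ α _ (below β)))

  encode-mono : ∀ β γ → proj₁ β ⪯ proj₁ γ → encode β ≤B encode γ
  encode-mono β γ β⪯γ with ⪯-decode⁻ α (encode γ) (subst (proj₁ β ⪯_) (sym (decode-encode γ)) β⪯γ)
  ... | x , x≤γ , eq = subst (_≤B encode γ) (decode-injective α _ _ (trans eq (sym (decode-encode β)))) x≤γ

DownIso-transport : ∀ {α B C} {_≤₁_ : B → B → Set} {_≤₂_ : C → C → Set} → DownIso α B _≤₁_ →
  (f : B → C) (g : C → B) → (∀ x → g (f x) ≡ x) → (∀ y → f (g y) ≡ y) →
  (∀ {x y} → x ≤₁ y → f x ≤₂ f y) → (∀ {x y} → f x ≤₂ f y → x ≤₁ y) → DownIso α C _≤₂_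
DownIso-transport I f g g∘f f∘g f-mono f-reflect = record
  { to      = λ β → f (to β)
  ; from    = λ y → from (g y)
  ; from-to = λ β → trans (cong (λ x → proj₁ (from x)) (g∘f (to β))) (from-to β)
  ; to-from = λ y → trans (cong f (to-from (g y))) (f∘g y)
  ; mono    = λ β γ β⪯γ → f-mono (mono β γ β⪯γ)
  ; reflect = λ β γ fβ≤fγ → reflect β γ (f-reflect fβ≤fγ)
  }
  where open DownIso I

flatten : ∀ rs → BProd rs → Subset (sum rs)
flatten []       _       = []
flatten (r ∷ rs) (S , x) = S ++ flatten rs x

unflatten : ∀ rs → Subset (sum rs) → BProd rs
unflatten []       _ = tt
unflatten (r ∷ rs) S = take r S , unflatten rs (drop r S)

unflatten-flatten : ∀ rs (x : BProd rs) → unflatten rs (flatten rs x) ≡ x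
unflatten-flatten []       tt      = refl
unflatten-flatten (r ∷ rs) (S , x)
  with ++-injective S (take r (S ++ flatten rs x)) (sym (take++drop≡id r (S ++ flatten rs x)))
... | S≡take , rest≡drop =
  cong₂ _,_ (sym S≡take) (trans (cong (unflatten rs) (sym rest≡drop)) (unflatten-flatten rs x))

flatten-unflatten : ∀ rs (S : Subset (sum rs)) → flatten rs (unflatten rs S) ≡ S
flatten-unflatten []       [] = refl
flatten-unflatten (r ∷ rs) S  = trans (cong (take r S ++_) (flatten-unflatten rs (drop r S))) (take++drop≡id r S)

flatten-mono : ∀ rs {x y : BProd rs} → x ≤B y → Pointwise _≤_ (flatten rs x) (flatten rs y)
flatten-mono []       _           = []
flatten-mono (r ∷ rs) (S⊆T , x≤y) = ++⁺ (⊆⇒pointwise S⊆T) (flatten-mono rs x≤y)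

flatten-reflect : ∀ rs {x y : BProd rs} → Pointwise _≤_ (flatten rs x) (flatten rs y) → x ≤B y
flatten-reflect []       _ = tt
flatten-reflect (r ∷ rs) {S , x} {T , y} p with ++⁻ S T p
... | S≤T , x≤y = pointwise⇒⊆ S≤T , flatten-reflect rs x≤y

proposition3p3 : (α : DComp) →
    DownIso α (BProd (ranks α)) _≤B_ × DownIso α (Subset (sum (ranks α))) _⊆_
proposition3p3 α =
  downIso α ,
  DownIso-transport (downIso α) (flatten rs) (unflatten rs) (unflatten-flatten rs) (flatten-unflatten rs)
    (λ x≤y → pointwise⇒⊆ (flatten-mono rs x≤y)) (λ fx⊆fy → flatten-reflect rs (⊆⇒pointwise fx⊆fy))
  where rs = ranks α
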